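{- Let $m\ge w\ge 1$, let $t\in\{1,2\}^k$ with $k\le w$, and let $S_1,S_2,S_3$ be subsets of $[m]$ of size $w$ that form a type $t$ clash. Then there is no $I(m,w)$ admissible set all of whose elements are of type $t$.
   Context: $[m]=\{1,\dots,m\}$. For $v\in\{0,1,2\}^m$, $\mathrm{Supp}\, v=\{i: v_i\neq0\}$; $V_S$ is the set of vectors in $\{0,1,2\}^m$ with support exactly $S$. A subset of $\{0,1,2\}^m$ is $I(m,w)$ if it contains exactly one element of $V_S$ for each $S\subseteq[m]$ with $|S|=w$ and no other elements. Two vectors form a clash if the support of one is contained in the support of the other. Three vectors $v_1,v_2,v_3$ form a clash if there is no coordinate at which exactly one of them is non-zero and no coordinate at which their three values are pairwise distinct. A set is admissible if it contains no clash (of two distinct or three distinct elements). For $t\in\{1,2\}^k$, a vector $v\in\{0,1,2\}^m$ is of type $t$ if $v$ has at least $k$ non-zero coordinates and, for each $i\le k$, the $i$-th non-zero coordinate of $v$ (in increasing order of index) equals $t_i$. Subsets $S_1,S_2,S_3$ of $[m]$ of size $w$ form a type $t$ clash if whenever $v_1\in V_{S_1}$, $v_2\in V_{S_2}$, $v_3\in V_{S_3}$ are all of type $t$, the triple $\{v_1,v_2,v_3\}$ is a clash. -}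

module Defs where

open import Data.Nat using (ℕ; zero; suc; _≤_)
open import Data.Fin using (Fin; zero; suc)
open import Data.Fin.Subset using (Subset; Side; inside; outside; _⊆_; ∣_∣)
open import Data.Vec using (Vec; []; _∷_; map; lookup; toList)
open import Data.List using (List; []; _∷_; _++_)
open import Data.Product using (Σ; _×_; ∃; ∃-syntax)
open import Data.Empty using (⊥)
open import Data.Unit using (⊤)
open import Data.Sum using (_⊎_)
open import Relation.Nullary using (¬_)
open import Relation.Binary.PropositionalEquality using (_≡_; _≢_)

Tern : ℕ → Set
Tern m = Vec (Fin 3) m

nz? : Fin 3 → Side
nz? zero    = outside
nz? (suc _) = inside

Supp : ∀ {m} → Tern m → Subset m
Supp = map nz?

InV : ∀ {m} → Subset m → Tern m → Set
InV S v = Supp v ≡ S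

nonzeros : ∀ {m} → Tern m → List (Fin 3)
nonzeros []            = []
nonzeros (zero  ∷ v)   = nonzeros v
nonzeros (suc x ∷ v)   = suc x ∷ nonzeros v

OfType : ∀ {m k} → Vec (Fin 3) k → Tern m → Set
OfType t v = ∃[ rest ] (nonzeros v ≡ toList t ++ rest)

Nonzero : ∀ {k} → Vec (Fin 3) k → Set
Nonzero t = ∀ i → lookup t i ≢ zero

ExactlyOneNZ : Fin 3 → Fin 3 → Fin 3 → Set
ExactlyOneNZ (suc _) zero zero = ⊤
ExactlyOneNZ zero (suc _) zero = ⊤
ExactlyOneNZ zero zero (suc _) = ⊤
ExactlyOneNZ _ _ _ = ⊥

PairwiseDistinct : Fin 3 → Fin 3 → Fin 3 → Set
PairwiseDistinct a b c = a ≢ b × a ≢ c × b ≢ c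

Clash2 : ∀ {m} → Tern m → Tern m → Set
Clash2 u v = (Supp u ⊆ Supp v) ⊎ (Supp v ⊆ Supp u)

Clash3 : ∀ {m} → Tern m → Tern m → Tern m → Set
Clash3 v₁ v₂ v₃ =
  (∀ i → ¬ ExactlyOneNZ (lookup v₁ i) (lookup v₂ i) (lookup v₃ i)) ×
  (∀ i → ¬ PairwiseDistinct (lookup v₁ i) (lookup v₂ i) (lookup v₃ i))

TSet : ℕ → Set₁
TSet m = Tern m → Set

IsI : (m w : ℕ) → TSet m → Set
IsI m w A =
  (∀ v → A v → ∣ Supp v ∣ ≡ w) ×
  (∀ (S : Subset m) → ∣ S ∣ ≡ w → ∃[ v ] (A v × InV S v)) ×
  (∀ u v → A u → A v → Supp u ≡ Supp v → u ≡ v)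

Admissible : ∀ {m} → TSet m → Set
Admissible A =
  (∀ u v → A u → A v → u ≢ v → ¬ Clash2 u v) ×
  (∀ u v x → A u → A v → A x → u ≢ v → u ≢ x → v ≢ x → ¬ Clash3 u v x)

TypeClash : ∀ {m k} → Vec (Fin 3) k → Subset m → Subset m → Subset m → Set
TypeClash t S₁ S₂ S₃ = ∀ v₁ v₂ v₃ →
  InV S₁ v₁ → InV S₂ v₂ → InV S₃ v₃ →
  OfType t v₁ → OfType t v₂ → OfType t v₃ →
  (v₁ ≢ v₂ × v₁ ≢ v₃ × v₂ ≢ v₃) × Clash3 v₁ v₂ v₃

{-# OPTIONS --safe #-}
module Submission where

open import Defs
open import Data.Nat using (ℕ; _≤_)
open import Data.Fin using (Fin)
open import Data.Fin.Subset using (Subset; ∣_∣)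
open import Data.Vec using (Vec)
open import Data.Product using (_×_; Σ; _,_; ∃-syntax)
open import Relation.Nullary using (¬_)
open import Relation.Binary.PropositionalEquality using (_≡_)

Meets : ∀ {m} → TSet m → Subset m → Set
Meets A S = ∃[ v ] (A v × InV S v)

AllOfType : ∀ {m k} → Vec (Fin 3) k → TSet m → Set
AllOfType t A = ∀ v → A v → OfType t v

IsI⇒meets : ∀ {m w} {A : TSet m} {S : Subset m} → IsI m w A → ∣ S ∣ ≡ w → Meets A S
IsI⇒meets (_ , cover , _) = cover _

admissible⇒¬typeClash : ∀ {m k} {t : Vec (Fin 3) k} {A : TSet m} {S₁ S₂ S₃ : Subset m} →
  Admissible A → AllOfType t A → Meets A S₁ → Meets A S₂ → Meets A S₃ →
  ¬ TypeClash t S₁ S₂ S₃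
admissible⇒¬typeClash (_ , no-clash₃) typed (v₁ , a₁ , s₁) (v₂ , a₂ , s₂) (v₃ , a₃ , s₃) clash
  with clash v₁ v₂ v₃ s₁ s₂ s₃ (typed v₁ a₁) (typed v₂ a₂) (typed v₃ a₃)
... | (v₁≢v₂ , v₁≢v₃ , v₂≢v₃) , clash₃ = no-clash₃ v₁ v₂ v₃ a₁ a₂ a₃ v₁≢v₂ v₁≢v₃ v₂≢v₃ clash₃

claim2 : (m w k : ℕ) → 1 ≤ w → w ≤ m → k ≤ w →
    (t : Vec (Fin 3) k) → Nonzero t →
    (S₁ S₂ S₃ : Subset m) → ∣ S₁ ∣ ≡ w → ∣ S₂ ∣ ≡ w → ∣ S₃ ∣ ≡ w →
    TypeClash t S₁ S₂ S₃ →
    ¬ (Σ (TSet m) λ A → IsI m w A × Admissible A × (∀ v → A v → OfType t v))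
claim2 m w k _ _ _ t _ S₁ S₂ S₃ ∣S₁∣ ∣S₂∣ ∣S₃∣ clash (A , isI , admissible , typed) =
  admissible⇒¬typeClash admissible typed
    (IsI⇒meets isI ∣S₁∣) (IsI⇒meets isI ∣S₂∣) (IsI⇒meets isI ∣S₃∣) clash
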